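{- Let $n$ be a positive integer, $q$ a prime power, $m(n)=\left[\frac{n^2}{4}\right]+1$, and let $c(n,k,q)$ be the number of orbits of $GL_n(\mathbb{F}_q)$, acting by simultaneous conjugation, on the set of $k$-tuples $(A_1,\ldots,A_k)$ of pairwise commuting matrices in $M_n(\mathbb{F}_q)$. Then there exists a constant $C_1>0$ (independent of $k$) such that $C_1 q^{m(n)k}\le c(n,k,q)$ for all sufficiently large $k$.
   Context: $\mathbb{F}_q$ is the finite field with $q$ elements; simultaneous conjugation is $g\cdot(A_1,\ldots,A_k)=(gA_1g^{ -1},\ldots,gA_kg^{ -1})$ for $g\in GL_n(\mathbb{F}_q)$; $[x]$ is the integer part of $x$. -}

module Defs where

open import Level using (0ℓ)
open import Data.Nat using (ℕ; suc; _^_)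
import Data.Nat as ℕ
open import Data.Nat.Primality using (Prime)
open import Data.Fin using (Fin; zero; suc; _≟_)
open import Data.Product using (Σ; ∃; ∃-syntax; _×_; _,_)
open import Data.Bool using (if_then_else_)
open import Relation.Nullary using (¬_; does)
open import Relation.Binary.PropositionalEquality using (_≡_)
import Relation.Binary.PropositionalEquality as ≡
open import Algebra.Bundles using (CommutativeRing)
open import Function.Bundles using (Inverse)

IsPrimePower : ℕ → Set
IsPrimePower q = ∃[ p ] ∃[ e ] (Prime p × q ≡ p ^ suc e)

record FiniteField (q : ℕ) : Set₁ where
  field
    commRing : CommutativeRing 0ℓ 0ℓ
  open CommutativeRing commRing public
  field
    0≉1     : ¬ (0# ≈ 1#)
    inverse : ∀ x → ¬ (x ≈ 0#) → ∃[ y ] (x * y ≈ 1#)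
    finite  : Inverse (≡.setoid (Fin q)) setoid

m : ℕ → ℕ
m n = (n ℕ.* n) ℕ./ 4 ℕ.+ 1

module Matrices {q : ℕ} (F : FiniteField q) where
  open FiniteField F using (Carrier; _≈_; _+_; _*_; 0#; 1#)

  Mat : ℕ → Set
  Mat n = Fin n → Fin n → Carrier

  sumF : ∀ {n} → (Fin n → Carrier) → Carrier
  sumF {ℕ.zero}  f = 0#
  sumF {suc n} f = f zero + sumF (λ i → f (suc i))

  _·_ : ∀ {n} → Mat n → Mat n → Mat n
  (A · B) i j = sumF (λ l → A i l * B l j)

  _≈M_ : ∀ {n} → Mat n → Mat n → Set
  A ≈M B = ∀ i j → A i j ≈ B i j

  I : ∀ {n} → Mat n
  I i j = if does (i ≟ j) then 1# else 0#

  Tuple : ℕ → ℕ → Set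
  Tuple n k = Fin k → Mat n

  Commuting : ∀ {n k} → Tuple n k → Set
  Commuting A = ∀ a b → (A a · A b) ≈M (A b · A a)

  Conjugate : ∀ {n k} → Tuple n k → Tuple n k → Set
  Conjugate {n} A B = ∃[ g ] ∃[ h ]
    (((g · h) ≈M I) × ((h · g) ≈M I) × (∀ a → ((g · A a) · h) ≈M B a))

  -- c is the number of GL_n(F)-orbits on commuting k-tuples:
  -- there is a family of c commuting tuples, pairwise in distinct orbits,
  -- meeting every orbit of commuting tuples.
  IsOrbitCount : ℕ → ℕ → ℕ → Set
  IsOrbitCount n k c = Σ (Fin c → Tuple n k) λ reps →
    (∀ a → Commuting (reps a)) ×
    (∀ a b → Conjugate (reps a) (reps b) → a ≡ b) ×
    (∀ A → Commuting A → ∃[ a ] Conjugate (reps a) A)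

module Submission where

-- Write n = p + r with p r = [n²/4]. Matrices x I + N with N supported on the upper right p × r
-- block commute pairwise (any two such N multiply to 0), which yields q^((1 + p r) k) = q^(m(n) k)
-- distinct commuting k-tuples. Each commuting tuple equals g R h for one of the c orbit
-- representatives R and some g, h ∈ M_n(F_q), so these tuples inject into the triples (R, g, h):
-- q^(m(n) k) ≤ c q^(2n²) for every k, i.e. C₁ = q^(-2n²) works with K = 0.

open import Defs
open import Data.Nat using (ℕ; zero; suc; _^_; _≤_; _<_; NonZero)
import Data.Nat as ℕ
open import Data.Nat.Properties using (m*n≢0; m^n≢0)
open import Data.Integer using (+_)
open import Data.Fin using (Fin; zero; suc; _≟_; splitAt; cast; _↑ˡ_; _↑ʳ_; combine; remQuot; finToFun; funToFin)
open import Data.Fin.Properties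
  using (nonZeroIndex; splitAt-↑ˡ; splitAt-↑ʳ; cast-involutive; combine-remQuot; remQuot-combine;
         combine-injective; finToFun-funToFin; funToFin-finToFin; injective⇒≤)
open import Data.Product using (∃-syntax; _×_; _,_; proj₁; proj₂; uncurry)
open import Data.Sum using (_⊎_; inj₁; inj₂)
open import Relation.Nullary.Decidable using (dec-true; dec-false)
open import Relation.Binary.PropositionalEquality using (_≡_; _≢_; refl; sym; trans; cong; cong₂; subst)
open import Function using (_∘_)
open import Function.Bundles using (Inverse; Injection)
open import Function.Properties.Inverse using (Inverse⇒Injection) renaming (sym to Inverse-sym)

module _ where
  open import Data.Nat using (_+_; _*_; _/_; z≤n; s≤s)
  open import Data.Nat.Properties using (+-comm; +-identityʳ)
  open import Data.Nat.DivMod using (m*n/n≡m; m<n⇒m/n≡0; +-distrib-/-∣ˡ)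
  open import Data.Nat.Divisibility using (divides)
  open import Data.Nat.Tactic.RingSolver using (solve)
  open import Data.List using ([]; _∷_)
  open import Relation.Binary.PropositionalEquality using (module ≡-Reasoning)
  open ≡-Reasoning

  even-or-odd : ∀ n → ∃[ t ] (n ≡ t * 2 ⊎ n ≡ t * 2 + 1)
  even-or-odd zero = 0 , inj₁ refl
  even-or-odd (suc n) with even-or-odd n
  ... | t , inj₁ refl = t , inj₂ (+-comm 1 (t * 2))
  ... | t , inj₂ refl = suc t , inj₁ (solve (t ∷ []))

  [b*4+r]/4≡b : ∀ b r → r < 4 → (b * 4 + r) / 4 ≡ b
  [b*4+r]/4≡b b r r<4 = begin
    (b * 4 + r) / 4    ≡⟨ +-distrib-/-∣ˡ r (divides b refl) ⟩
    b * 4 / 4 + r / 4  ≡⟨ cong₂ _+_ (m*n/n≡m b 4) (m<n⇒m/n≡0 r<4) ⟩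
    b + 0              ≡⟨ +-identityʳ b ⟩
    b                  ∎

  n²≡4b+r⇒m≡1+b : ∀ n b r → r < 4 → n * n ≡ b * 4 + r → m n ≡ suc b
  n²≡4b+r⇒m≡1+b n b r r<4 n²≡4b+r = begin
    (n * n) / 4 + 1      ≡⟨ cong (λ z → z / 4 + 1) n²≡4b+r ⟩
    (b * 4 + r) / 4 + 1  ≡⟨ cong (_+ 1) ([b*4+r]/4≡b b r r<4) ⟩
    b + 1                ≡⟨ +-comm b 1 ⟩
    suc b                ∎

  m≡1+p*r : ∀ n → ∃[ p ] ∃[ r ] (n ≡ p + r × m n ≡ suc (p * r))
  m≡1+p*r n with even-or-odd n
  ... | t , inj₁ refl = t , t , solve (t ∷ []) , n²≡4b+r⇒m≡1+b (t * 2) (t * t) 0 (s≤s z≤n) (solve (t ∷ []))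
  ... | t , inj₂ refl = t , suc t , solve (t ∷ []) ,
    n²≡4b+r⇒m≡1+b (t * 2 + 1) (t * suc t) 1 (s≤s (s≤s z≤n)) (solve (t ∷ []))

open import Data.Rational using (_/_; 0ℚ)
import Data.Rational as ℚ

module _ where
  open import Data.Nat using (_*_; z≤n; s≤s)
  open import Relation.Binary.PropositionalEquality using (subst₂)
  import Data.Integer as ℤ
  import Data.Integer.Properties as ℤ
  import Data.Rational.Properties as ℚ
  import Data.Rational.Unnormalised as ℚᵘ
  import Data.Rational.Unnormalised.Properties as ℚᵘ
  open import Data.Nat.Coprimality using (1-coprimeTo) renaming (sym to coprime-sym)

  private
    [_]/1 : ℕ → ℚ.ℚ
    [ N ]/1 = ℚ.mkℚ (+ N) 0 (coprime-sym (1-coprimeTo N))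

    1/[1+_] : ℕ → ℚ.ℚ
    1/[1+ d ] = ℚ.mkℚ (+ 1) d (1-coprimeTo (suc d))

    N/1≡[N]/1 : ∀ N → (+ N) / 1 ≡ [ N ]/1
    N/1≡[N]/1 N = ℚ.normalize-coprime (coprime-sym (1-coprimeTo N))

    1/suc≡1/[1+] : ∀ d → (+ 1) / suc d ≡ 1/[1+ d ]
    1/suc≡1/[1+] d = ℚ.normalize-coprime (1-coprimeTo (suc d))

  1/d-positive : ∀ d .{{_ : NonZero d}} → 0ℚ ℚ.< (+ 1) / d
  1/d-positive (suc d) rewrite 1/suc≡1/[1+] d = ℚ.*<* (ℤ.+<+ (s≤s z≤n))

  1/d*N≤c : ∀ N c d .{{_ : NonZero d}} → N ≤ c * d → ((+ 1) / d) ℚ.* ((+ N) / 1) ℚ.≤ (+ c) / 1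
  1/d*N≤c N c (suc d) N≤cd rewrite 1/suc≡1/[1+] d | N/1≡[N]/1 N | N/1≡[N]/1 c =
    ℚ.toℚᵘ-cancel-≤
      (ℚᵘ.≤-respˡ-≃ (ℚᵘ.≃-sym (ℚ.toℚᵘ-homo-* 1/[1+ d ] [ N ]/1)) (ℚᵘ.*≤* cross-multiplied))
    where
    cross-multiplied : ((+ 1) ℤ.* (+ N)) ℤ.* (+ 1) ℤ.≤ (+ c) ℤ.* ((+ suc d) ℤ.* (+ 1))
    cross-multiplied = subst₂ ℤ._≤_
      (sym (trans (ℤ.*-identityʳ _) (ℤ.*-identityˡ (+ N))))
      (sym (trans (cong ((+ c) ℤ.*_) (ℤ.*-identityʳ (+ suc d))) (sym (ℤ.pos-* c (suc d)))))
      (ℤ.+≤+ N≤cd)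

funToFin-cong : ∀ {a b} {f g : Fin a → Fin b} → (∀ i → f i ≡ g i) → funToFin f ≡ funToFin g
funToFin-cong {zero}  f≗g = refl
funToFin-cong {suc a} f≗g = cong₂ combine (f≗g zero) (funToFin-cong (λ i → f≗g (suc i)))

finToFun-injective : ∀ {a b} {x y : Fin (b ^ a)} → (∀ i → finToFun {b} {a} x i ≡ finToFun y i) → x ≡ y
finToFun-injective {a} {b} {x} {y} x≗y =
  trans (sym (funToFin-finToFin {a} {b} x)) (trans (funToFin-cong x≗y) (funToFin-finToFin {a} {b} y))

module MatrixAlgebra {q : ℕ} (F : FiniteField q) where
  open FiniteField F
    using (Carrier; _≈_; _+_; _*_; 0#; setoid; +-commutativeSemigroup; +-cong; +-congˡ; +-congʳ;
           +-identityˡ; +-identityʳ; *-cong; *-comm; reflexive; zeroˡ; zeroʳ; distribˡ; distribʳ; finite)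
    renaming (refl to ≈-refl; sym to ≈-sym; trans to ≈-trans)
  open Matrices F
  open import Relation.Binary.Reasoning.Setoid setoid
  open import Algebra.Properties.CommutativeSemigroup +-commutativeSemigroup using (interchange)
  open import Data.Bool using (true; false; if_then_else_)
  open import Relation.Nullary using (does)

  ≈M-refl : ∀ {n} {A : Mat n} → A ≈M A
  ≈M-refl i j = ≈-refl

  ≈M-sym : ∀ {n} {A B : Mat n} → A ≈M B → B ≈M A
  ≈M-sym A≈B i j = ≈-sym (A≈B i j)

  ≈M-trans : ∀ {n} {A B C : Mat n} → A ≈M B → B ≈M C → A ≈M C
  ≈M-trans A≈B B≈C i j = ≈-trans (A≈B i j) (B≈C i j)

  _≈T_ : ∀ {n k} → Tuple n k → Tuple n k → Set
  A ≈T B = ∀ t → A t ≈M B t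

  _+M_ : ∀ {n} → Mat n → Mat n → Mat n
  (A +M B) i j = A i j + B i j

  scalar : ∀ {n} → Carrier → Mat n
  scalar x i j = if does (i ≟ j) then x else 0#

  sumF-cong : ∀ {n} {f g : Fin n → Carrier} → (∀ i → f i ≈ g i) → sumF f ≈ sumF g
  sumF-cong {zero}  f≈g = ≈-refl
  sumF-cong {suc n} f≈g = +-cong (f≈g zero) (sumF-cong (λ i → f≈g (suc i)))

  sumF-+ : ∀ {n} (f g : Fin n → Carrier) → sumF (λ i → f i + g i) ≈ sumF f + sumF g
  sumF-+ {zero}  f g = ≈-sym (+-identityˡ 0#)
  sumF-+ {suc n} f g = begin
    (f zero + g zero) + sumF (λ i → f (suc i) + g (suc i))
      ≈⟨ +-congˡ (sumF-+ (λ i → f (suc i)) (λ i → g (suc i))) ⟩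
    (f zero + g zero) + (sumF (λ i → f (suc i)) + sumF (λ i → g (suc i)))
      ≈⟨ interchange _ _ _ _ ⟩
    (f zero + sumF (λ i → f (suc i))) + (g zero + sumF (λ i → g (suc i))) ∎

  sumF-zero : ∀ {n} (f : Fin n → Carrier) → (∀ i → f i ≈ 0#) → sumF f ≈ 0#
  sumF-zero {zero}  f f≈0 = ≈-refl
  sumF-zero {suc n} f f≈0 =
    ≈-trans (+-cong (f≈0 zero) (sumF-zero _ (λ i → f≈0 (suc i)))) (+-identityˡ 0#)

  sumF-scalarˡ : ∀ {n} x (i : Fin n) (v : Fin n → Carrier) → sumF (λ l → scalar x i l * v l) ≈ x * v i
  sumF-scalarˡ {suc n} x zero v = begin
    x * v zero + sumF (λ l → 0# * v (suc l))  ≈⟨ +-congˡ (sumF-zero {n} _ (λ l → zeroˡ _)) ⟩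
    x * v zero + 0#                           ≈⟨ +-identityʳ _ ⟩
    x * v zero                                ∎
  sumF-scalarˡ {suc n} x (suc i) v = begin
    0# * v zero + sumF (λ l → scalar x i l * v (suc l))  ≈⟨ +-cong (zeroˡ _) (sumF-scalarˡ x i (λ l → v (suc l))) ⟩
    0# + x * v (suc i)                                   ≈⟨ +-identityˡ _ ⟩
    x * v (suc i)                                        ∎

  sumF-scalarʳ : ∀ {n} x (j : Fin n) (v : Fin n → Carrier) → sumF (λ l → v l * scalar x l j) ≈ v j * x
  sumF-scalarʳ {suc n} x zero v = begin
    v zero * x + sumF (λ l → v (suc l) * 0#)  ≈⟨ +-congˡ (sumF-zero {n} _ (λ l → zeroʳ _)) ⟩
    v zero * x + 0#                           ≈⟨ +-identityʳ _ ⟩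
    v zero * x                                ∎
  sumF-scalarʳ {suc n} x (suc j) v = begin
    v zero * 0# + sumF (λ l → v (suc l) * scalar x l j)  ≈⟨ +-cong (zeroʳ _) (sumF-scalarʳ x j (λ l → v (suc l))) ⟩
    0# + v (suc j) * x                                   ≈⟨ +-identityˡ _ ⟩
    v (suc j) * x                                        ∎

  ·-cong : ∀ {n} {A A′ B B′ : Mat n} → A ≈M A′ → B ≈M B′ → (A · B) ≈M (A′ · B′)
  ·-cong A≈A′ B≈B′ i j = sumF-cong (λ l → *-cong (A≈A′ i l) (B≈B′ l j))

  scalar-diagonal : ∀ {n} x (i : Fin n) → scalar x i i ≡ x
  scalar-diagonal x i rewrite dec-true (i ≟ i) refl = refl

  scalar-offDiagonal : ∀ {n} x {i j : Fin n} → i ≢ j → scalar x i j ≡ 0#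
  scalar-offDiagonal x {i} {j} i≢j rewrite dec-false (i ≟ j) i≢j = refl

  *-scalar-comm : ∀ {n} x y (i j : Fin n) → x * scalar y i j ≈ y * scalar x i j
  *-scalar-comm x y i j with does (i ≟ j)
  ... | true  = *-comm x y
  ... | false = ≈-trans (zeroʳ x) (≈-sym (zeroʳ y))

  scalar+-· : ∀ {n} x (N B : Mat n) i j → ((scalar x +M N) · B) i j ≈ x * B i j + (N · B) i j
  scalar+-· {n} x N B i j = begin
    sumF (λ l → (scalar x i l + N i l) * B l j)                ≈⟨ sumF-cong {n} (λ l → distribʳ _ _ _) ⟩
    sumF (λ l → scalar x i l * B l j + N i l * B l j)          ≈⟨ sumF-+ {n} _ _ ⟩
    sumF (λ l → scalar x i l * B l j) + sumF (λ l → N i l * B l j)  ≈⟨ +-congʳ (sumF-scalarˡ x i (λ l → B l j)) ⟩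
    x * B i j + (N · B) i j                                    ∎

  ·-scalar+ : ∀ {n} y (N N′ : Mat n) i j → (N · (scalar y +M N′)) i j ≈ N i j * y + (N · N′) i j
  ·-scalar+ {n} y N N′ i j = begin
    sumF (λ l → N i l * (scalar y l j + N′ l j))                 ≈⟨ sumF-cong {n} (λ l → distribˡ _ _ _) ⟩
    sumF (λ l → N i l * scalar y l j + N i l * N′ l j)           ≈⟨ sumF-+ {n} _ _ ⟩
    sumF (λ l → N i l * scalar y l j) + sumF (λ l → N i l * N′ l j)  ≈⟨ +-congʳ (sumF-scalarʳ y j (N i)) ⟩
    N i j * y + (N · N′) i j                                     ∎

  scalar+-·-scalar+ : ∀ {n} x y (N N′ : Mat n) i j →
    ((scalar x +M N) · (scalar y +M N′)) i j ≈ (x * scalar y i j + N i j * y) + (x * N′ i j + (N · N′) i j)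
  scalar+-·-scalar+ x y N N′ i j = begin
    ((scalar x +M N) · (scalar y +M N′)) i j              ≈⟨ scalar+-· x N (scalar y +M N′) i j ⟩
    x * (scalar y i j + N′ i j) + (N · (scalar y +M N′)) i j  ≈⟨ +-cong (distribˡ _ _ _) (·-scalar+ y N N′ i j) ⟩
    (x * scalar y i j + x * N′ i j) + (N i j * y + (N · N′) i j)  ≈⟨ interchange _ _ _ _ ⟩
    (x * scalar y i j + N i j * y) + (x * N′ i j + (N · N′) i j)  ∎

  scalar+-commute : ∀ {n} x y {N N′ : Mat n} → (N · N′) ≈M (N′ · N) →
    ((scalar x +M N) · (scalar y +M N′)) ≈M ((scalar y +M N′) · (scalar x +M N))
  scalar+-commute x y {N} {N′} NN′≈N′N i j = begin
    ((scalar x +M N) · (scalar y +M N′)) i j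
      ≈⟨ scalar+-·-scalar+ x y N N′ i j ⟩
    (x * scalar y i j + N i j * y) + (x * N′ i j + (N · N′) i j)
      ≈⟨ interchange _ _ _ _ ⟩
    (x * scalar y i j + x * N′ i j) + (N i j * y + (N · N′) i j)
      ≈⟨ +-cong (+-cong (*-scalar-comm x y i j) (*-comm _ _)) (+-cong (*-comm _ _) (NN′≈N′N i j)) ⟩
    (y * scalar x i j + N′ i j * x) + (y * N i j + (N′ · N) i j)
      ≈⟨ scalar+-·-scalar+ y x N′ N i j ⟨
    ((scalar y +M N′) · (scalar x +M N)) i j ∎

  private module Enc = Inverse finite

  to-injective : ∀ {a b} → Enc.to a ≈ Enc.to b → a ≡ b
  to-injective = Injection.injective (Inverse⇒Injection finite)

  from-injective : ∀ {x y} → Enc.from x ≡ Enc.from y → x ≈ y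
  from-injective = Injection.injective (Inverse⇒Injection (Inverse-sym finite))

  encode : ∀ {n} → Mat n → Fin (q ^ (n ℕ.* n))
  encode {n} A = funToFin (λ w → Enc.from (uncurry A (remQuot n w)))

  finToFun-encode : ∀ {n} (A : Mat n) i j → finToFun (encode A) (combine i j) ≡ Enc.from (A i j)
  finToFun-encode {n} A i j =
    trans (finToFun-funToFin _ (combine i j)) (cong (Enc.from ∘ uncurry A) (remQuot-combine i j))

  encode-injective : ∀ {n} {A B : Mat n} → encode A ≡ encode B → A ≈M B
  encode-injective {n} {A} {B} eq i j = from-injective
    (trans (sym (finToFun-encode A i j)) (trans (cong (λ e → finToFun e (combine i j)) eq) (finToFun-encode B i j)))

  module _ {n k c : ℕ} (orbits : IsOrbitCount n k c) where
    private
      reps : Fin c → Tuple n k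
      reps = proj₁ orbits

      meets-every-orbit : ∀ A → Commuting A → ∃[ a ] Conjugate (reps a) A
      meets-every-orbit = proj₂ (proj₂ (proj₂ orbits))

    encodeConjugation : ∀ {A} → ∃[ a ] Conjugate (reps a) A → Fin (c ℕ.* (q ^ (n ℕ.* n) ℕ.* q ^ (n ℕ.* n)))
    encodeConjugation (a , g , h , _) = combine a (combine (encode g) (encode h))

    encodeConjugation-injective : ∀ {A B} (u : ∃[ a ] Conjugate (reps a) A) (v : ∃[ a ] Conjugate (reps a) B) →
      encodeConjugation u ≡ encodeConjugation v → A ≈T B
    encodeConjugation-injective (a , g , h , _ , _ , gah≈A) (a′ , g′ , h′ , _ , _ , g′a′h′≈B) eq
      with combine-injective a _ a′ _ eq
    ... | refl , eq′ with combine-injective (encode g) (encode h) (encode g′) (encode h′) eq′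
    ... | g≡g′ , h≡h′ = λ t →
      ≈M-trans (≈M-sym (gah≈A t))
        (≈M-trans (·-cong (·-cong (encode-injective g≡g′) ≈M-refl) (encode-injective h≡h′)) (g′a′h′≈B t))

    commuting-family-≤ : ∀ {N} (T : Fin N → Tuple n k) → (∀ x → Commuting (T x)) →
      (∀ {x y} → T x ≈T T y → x ≡ y) → N ≤ c ℕ.* (q ^ (n ℕ.* n) ℕ.* q ^ (n ℕ.* n))
    commuting-family-≤ T commuting T-injective =
      injective⇒≤ (λ {x} {y} eq → T-injective (encodeConjugation-injective (witness x) (witness y) eq))
      where
      witness : ∀ x → ∃[ a ] Conjugate (reps a) (T x)
      witness x = meets-every-orbit (T x) (commuting x)

  module Corner {n p r : ℕ} (n≡p+r : n ≡ p ℕ.+ r) where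
    block : Fin n → Fin p ⊎ Fin r
    block i = splitAt p (cast n≡p+r i)

    upperRight : (Fin p → Fin r → Carrier) → Fin p ⊎ Fin r → Fin p ⊎ Fin r → Carrier
    upperRight X (inj₁ a) (inj₂ b) = X a b
    upperRight X (inj₁ a) (inj₁ b) = 0#
    upperRight X (inj₂ a) v        = 0#

    upperRight-diagonal : ∀ X s → upperRight X s s ≈ 0#
    upperRight-diagonal X (inj₁ a) = ≈-refl
    upperRight-diagonal X (inj₂ b) = ≈-refl

    upperRight-*-upperRight : ∀ X Y s u v → upperRight X s u * upperRight Y u v ≈ 0#
    upperRight-*-upperRight X Y (inj₁ a) (inj₁ b) v = zeroˡ _
    upperRight-*-upperRight X Y (inj₂ a) (inj₁ b) v = zeroˡ _
    upperRight-*-upperRight X Y s        (inj₂ b) v = zeroʳ _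

    corner : (Fin p → Fin r → Carrier) → Mat n
    corner X i j = upperRight X (block i) (block j)

    corner-·-corner : ∀ X Y i j → (corner X · corner Y) i j ≈ 0#
    corner-·-corner X Y i j = sumF-zero {n} _ (λ l → upperRight-*-upperRight X Y (block i) (block l) (block j))

    corners-commute : ∀ X Y → (corner X · corner Y) ≈M (corner Y · corner X)
    corners-commute X Y i j = ≈-trans (corner-·-corner X Y i j) (≈-sym (corner-·-corner Y X i j))

    row : Fin p → Fin n
    row a = cast (sym n≡p+r) (a ↑ˡ r)

    col : Fin r → Fin n
    col b = cast (sym n≡p+r) (p ↑ʳ b)

    block-row : ∀ a → block (row a) ≡ inj₁ a
    block-row a = trans (cong (splitAt p) (cast-involutive n≡p+r (sym n≡p+r) (a ↑ˡ r))) (splitAt-↑ˡ p a r)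

    block-col : ∀ b → block (col b) ≡ inj₂ b
    block-col b = trans (cong (splitAt p) (cast-involutive n≡p+r (sym n≡p+r) (p ↑ʳ b))) (splitAt-↑ʳ p r b)

    row≢col : ∀ a b → row a ≢ col b
    row≢col a b row≡col with () ← trans (sym (block-row a)) (trans (cong block row≡col) (block-col b))

    scalar+corner : Carrier → (Fin p → Fin r → Carrier) → Mat n
    scalar+corner x X = scalar x +M corner X

    scalar+corner-diagonal : ∀ x X i → scalar+corner x X i i ≈ x
    scalar+corner-diagonal x X i =
      ≈-trans (+-cong (reflexive (scalar-diagonal x i)) (upperRight-diagonal X (block i))) (+-identityʳ x)

    scalar+corner-entry : ∀ x X a b → scalar+corner x X (row a) (col b) ≈ X a b
    scalar+corner-entry x X a b =
      ≈-trans (+-cong (reflexive (scalar-offDiagonal x (row≢col a b)))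
                      (reflexive (cong₂ (upperRight X) (block-row a) (block-col b))))
              (+-identityˡ (X a b))

    -- Coordinate zero is the scalar part, coordinate suc (combine a b) the corner entry (a, b).
    cornerTuple : ∀ {k} → (Fin k → Fin (suc (p ℕ.* r)) → Carrier) → Tuple n k
    cornerTuple φ t = scalar+corner (φ t zero) (λ a b → φ t (suc (combine a b)))

    cornerTuple-commuting : ∀ {k} φ → Commuting (cornerTuple {k} φ)
    cornerTuple-commuting φ s t = scalar+-commute _ _ (corners-commute _ _)

    cornerTuple-injective : ∀ {k} {φ ψ} → Fin n → cornerTuple {k} φ ≈T cornerTuple ψ → ∀ t u → φ t u ≈ ψ t u
    cornerTuple-injective i₀ φ≈ψ t zero =
      ≈-trans (≈-sym (scalar+corner-diagonal _ _ i₀)) (≈-trans (φ≈ψ t i₀ i₀) (scalar+corner-diagonal _ _ i₀))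
    cornerTuple-injective {φ = φ} {ψ} i₀ φ≈ψ t (suc w) =
      subst (λ w → φ t (suc w) ≈ ψ t (suc w)) (combine-remQuot {p} r w) (entry (remQuot {p} r w))
      where
      entry : ∀ ((a , b) : Fin p × Fin r) → φ t (suc (combine a b)) ≈ ψ t (suc (combine a b))
      entry (a , b) = ≈-trans (≈-sym (scalar+corner-entry _ _ a b))
        (≈-trans (φ≈ψ t (row a) (col b)) (scalar+corner-entry _ _ a b))

    decode : ∀ {k} → Fin (q ^ (suc (p ℕ.* r) ℕ.* k)) → Fin k → Fin (suc (p ℕ.* r)) → Carrier
    decode x t u = Enc.to (finToFun x (combine u t))

    codedTuple : ∀ {k} → Fin (q ^ (suc (p ℕ.* r) ℕ.* k)) → Tuple n k
    codedTuple x = cornerTuple (decode x)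

    codedTuple-injective : ∀ {k} → Fin n → ∀ {x y} → codedTuple {k} x ≈T codedTuple y → x ≡ y
    codedTuple-injective {k} i₀ {x} {y} x≈y = finToFun-injective (λ w →
      let (u , t) = remQuot {suc (p ℕ.* r)} k w in
      subst (λ w → finToFun x w ≡ finToFun y w) (combine-remQuot k w)
        (to-injective (cornerTuple-injective {φ = decode x} {decode y} i₀ x≈y t u)))

  orbit-count-lower-bound : ∀ n {k c} → IsOrbitCount (suc n) k c →
    q ^ (m (suc n) ℕ.* k) ≤ c ℕ.* (q ^ (suc n ℕ.* suc n) ℕ.* q ^ (suc n ℕ.* suc n))
  orbit-count-lower-bound n orbits with m≡1+p*r (suc n)
  ... | p , r , n≡p+r , m≡1+pr rewrite m≡1+pr =
    commuting-family-≤ orbits codedTuple (λ x → cornerTuple-commuting (decode x)) (codedTuple-injective zero)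
    where open Corner {p = p} {r} n≡p+r

lemma2 : (n : ℕ) → 1 ≤ n → (q : ℕ) → IsPrimePower q → (F : FiniteField q) →
    ∃[ C₁ ] (0ℚ ℚ.< C₁ × ∃[ K ] (∀ k → K ≤ k → ∀ c → Matrices.IsOrbitCount F n k c →
      C₁ ℚ.* ((+ (q ^ (m n ℕ.* k))) / 1) ℚ.≤ ((+ c) / 1)))
lemma2 (suc n) _ q _ F =
  (+ 1) / Q , 1/d-positive Q , 0 , λ k _ c orbits →
    1/d*N≤c _ c Q (MatrixAlgebra.orbit-count-lower-bound F n orbits)
  where
  Q′ Q : ℕ
  Q′ = q ^ (suc n ℕ.* suc n)
  Q = Q′ ℕ.* Q′
  instance
    q≢0 : NonZero q
    q≢0 = nonZeroIndex (Inverse.from (FiniteField.finite F) (FiniteField.0# F))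
    Q′≢0 : NonZero Q′
    Q′≢0 = m^n≢0 q (suc n ℕ.* suc n)
    Q≢0 : NonZero Q
    Q≢0 = m*n≢0 Q′ Q′
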